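{- For every set of ground terms $\Lambda$ and every evaluation $p$ on $\Lambda$, $\ulcorner p\urcorner\leqslant\mathcal P(\omega_1(\ulcorner\Lambda\urcorner))$, i.e. $\ulcorner p\urcorner\leqslant \omega_1(\ulcorner\Lambda\urcorner)^n+n$ for some standard $n$.
   Context: Language $\langle 0,\mathfrak s,+,\cdot,\leqslant\rangle$ extended by Skolem function symbols; atomic formulas over $\Lambda$ are $t=s$ and $t\leqslant s$ with $t,s\in\Lambda$. An evaluation on $\Lambda$ is a map from these atomic formulas to $\{0,1\}$ with $p[t=t]=1$ and $p[t=s]=1\Rightarrow p[\varphi(t)]=p[\varphi(s)]$; it is coded as the set of pairs $\langle\text{atomic formula},i\rangle$. $\ulcorner\cdot\urcorner$ is the efficient Gödel coding of Hájek–Pudlák Ch. V (with $\ulcorner\langle a\rangle\urcorner\leqslant 9(\ulcorner a\urcorner+1)^2$, codes of unions/concatenations bounded by $64$ times the product of codes, and cardinality of a coded set at most $\log$ of its code). $\omega_1(x)=2^{(\log x)^2}$. -}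

module Defs where

open import Data.Nat using (ℕ; zero; suc; _+_; _*_; _^_; _/_; _%_; _<ᵇ_; _≡ᵇ_)
open import Data.Nat.Logarithm using (⌊log₂_⌋)
open import Data.Bool using (Bool; true; false; if_then_else_)
open import Data.List using (List; []; _∷_; _++_; [_]; length; map; concat; concatMap; foldl; foldr)
open import Data.List.Membership.Propositional using (_∈_)
open import Data.Empty using (⊥)
open import Data.Unit using (⊤)
open import Data.Product using (_×_)
open import Relation.Binary.PropositionalEquality using (_≡_)

-- Efficient coding of finite sequences of numbers (in the spirit of
-- Hájek–Pudlák Ch. V): a sequence ⟨a₁,…,aₖ⟩ is the base-4 number whose
-- digit string is 1 · bin(a₁) 2 · bin(a₂) 2 ⋯ bin(aₖ) 2, where bin(a)
-- is the binary expansion of a (most significant bit first, empty for 0)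
-- and 2 is a separator.

binF : ℕ → ℕ → List ℕ
binF zero    _ = []
binF (suc f) zero = []
binF (suc f) n@(suc _) = binF f (n / 2) ++ [ n % 2 ]

bin : ℕ → List ℕ
bin n = binF n n

digits : List ℕ → List ℕ
digits l = concatMap (λ a → bin a ++ [ 2 ]) l

seqCode : List ℕ → ℕ
seqCode l = foldl (λ c d → 4 * c + d) 1 (digits l)

pairCode : ℕ → ℕ → ℕ
pairCode a b = seqCode (a ∷ b ∷ [])

-- Finite sets of numbers are coded as the code of the strictly increasing
-- sequence of their elements.
insertSet : ℕ → List ℕ → List ℕ
insertSet x [] = x ∷ []
insertSet x (y ∷ ys) =
  if x <ᵇ y then x ∷ y ∷ ys
  else (if x ≡ᵇ y then y ∷ ys else y ∷ insertSet x ys)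

toSortedSet : List ℕ → List ℕ
toSortedSet = foldr insertSet []

setCode : List ℕ → ℕ
setCode l = seqCode (toSortedSet l)

-- Terms of the language ⟨0, 𝔰, +, ·, ≤⟩ extended by Skolem function
-- symbols f_i (applied to a list of arguments; the symbol is determined
-- by the index i together with its arity), with variables from V.

data Tm (V : Set) : Set where
  var  : V → Tm V
  zer  : Tm V
  succ : Tm V → Tm V
  plus : Tm V → Tm V → Tm V
  times : Tm V → Tm V → Tm V
  sk   : ℕ → List (Tm V) → Tm V

GroundTerm : Set
GroundTerm = Tm ⊥

mutual
  substT : Tm ⊤ → GroundTerm → GroundTerm
  substT (var _) u = u
  substT zer u = zer
  substT (succ t) u = succ (substT t u)
  substT (plus t s) u = plus (substT t u) (substT s u)
  substT (times t s) u = times (substT t u) (substT s u)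
  substT (sk i ts) u = sk i (substTs ts u)

  substTs : List (Tm ⊤) → GroundTerm → List GroundTerm
  substTs [] u = []
  substTs (t ∷ ts) u = substT t u ∷ substTs ts u

-- Symbol codes: 0 ↦ 0, 𝔰 ↦ 1, + ↦ 2, · ↦ 3, = ↦ 4, ≤ ↦ 5, x ↦ 6,
-- f_i of arity k ↦ 7 + ⟨i,k⟩.  Terms/formulas are coded as the sequence
-- of their symbols in Polish notation.
mutual
  polish : {V : Set} → Tm V → List ℕ
  polish (var _) = 6 ∷ []
  polish zer = 0 ∷ []
  polish (succ t) = 1 ∷ polish t
  polish (plus t s) = 2 ∷ polish t ++ polish s
  polish (times t s) = 3 ∷ polish t ++ polish s
  polish (sk i ts) = (7 + pairCode i (length ts)) ∷ polishs ts

  polishs : {V : Set} → List (Tm V) → List ℕ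
  polishs [] = []
  polishs (t ∷ ts) = polish t ++ polishs ts

termCode : GroundTerm → ℕ
termCode t = seqCode (polish t)

setOfTermsCode : List GroundTerm → ℕ
setOfTermsCode Λ = setCode (map termCode Λ)

data Atom (V : Set) : Set where
  _≐_ : Tm V → Tm V → Atom V
  _≼_ : Tm V → Tm V → Atom V

substA : Atom ⊤ → GroundTerm → Atom ⊥
substA (t ≐ s) u = substT t u ≐ substT s u
substA (t ≼ s) u = substT t u ≼ substT s u

atomCode : Atom ⊥ → ℕ
atomCode (t ≐ s) = seqCode (4 ∷ polish t ++ polish s)
atomCode (t ≼ s) = seqCode (5 ∷ polish t ++ polish s)

data AtomOver (Λ : List GroundTerm) : Atom ⊥ → Set where
  eqOver : ∀ {t s} → t ∈ Λ → s ∈ Λ → AtomOver Λ (t ≐ s)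
  leOver : ∀ {t s} → t ∈ Λ → s ∈ Λ → AtomOver Λ (t ≼ s)

-- An evaluation on Λ: a {0,1}-valued map on atomic formulas over Λ
-- (given as a map on all atomic formulas; only values on atomic
-- formulas over Λ matter) such that p[t=t]=1 and
-- p[t=s]=1 ⇒ p[φ(t)] = p[φ(s)].
record IsEvaluation (Λ : List GroundTerm) (p : Atom ⊥ → Bool) : Set where
  field
    refl-eval  : ∀ {t} → t ∈ Λ → p (t ≐ t) ≡ true
    congr-eval : ∀ {t s} → t ∈ Λ → s ∈ Λ → p (t ≐ s) ≡ true →
                 (φ : Atom ⊤) → AtomOver Λ (substA φ t) → AtomOver Λ (substA φ s) →
                 p (substA φ t) ≡ p (substA φ s)

bit : Bool → ℕ
bit true = 1
bit false = 0

atomsOver : List GroundTerm → List (Atom ⊥)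
atomsOver Λ = concatMap (λ t → concatMap (λ s → (t ≐ s) ∷ (t ≼ s) ∷ []) Λ) Λ

evalCode : List GroundTerm → (Atom ⊥ → Bool) → ℕ
evalCode Λ p = setCode (map (λ φ → pairCode (atomCode φ) (bit (p φ))) (atomsOver Λ))

ω₁ : ℕ → ℕ
ω₁ x = 2 ^ (⌊log₂ x ⌋ ^ 2)

-- A sequence code is a base-4 numeral in which every entry a occupies a block of
-- bitLength a + 1 digits.  Hence ⌜p⌝ < 2 ^ (1 + 2 D), where D is the total block
-- length of the entries ⟨⌜φ⌝, p[φ]⟩ of p, while ⌊log₂ ⌜Λ⌝⌋ ≥ 2 L, where L is the
-- total block length of the distinct term codes.  The code of a concatenation is a
-- function of the codes of its parts, with bit length at most the sum of theirs, so
-- every entry is a function of a quadruple (⌜t⌝, ⌜s⌝, relation symbol, truth value)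
-- with ⌜t⌝, ⌜s⌝ among the term codes, of block length O(|⌜t⌝| · |⌜s⌝|).  Since the
-- entries are distinct, D is at most the sum over all quadruples, which is O(L²);
-- whence ⌜p⌝ ≤ 2 ^ O((log ⌜Λ⌝)²).
module Submission where

open import Defs
open import Data.Bool using (Bool; true; false; T)
open import Data.Empty using (⊥; ⊥-elim)
open import Data.List using (List; []; _∷_; _++_; [_]; length; map; concat; concatMap; foldl; filter)
open import Data.List.Properties using (foldl-++; length-++; map-++; concat-++; filter-all)
open import Data.List.Membership.Propositional using (_∈_; find; lose)
open import Data.List.Membership.Propositional.Properties using (∈-map⁺; ∈-map⁻; ∈-filter⁻; ∈-concatMap⁺; ∈-concatMap⁻)
open import Data.List.Relation.Binary.Subset.Propositional using (_⊆_)
open import Data.List.Relation.Unary.All as All using (All; []; _∷_)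
open import Data.List.Relation.Unary.All.Properties using (++⁺)
open import Data.List.Relation.Unary.AllPairs as AllPairs using (AllPairs; []; _∷_)
open import Data.List.Relation.Unary.Any using (here; there)
open import Data.List.Relation.Unary.Unique.Propositional using (Unique)
import Data.List.Relation.Unary.Unique.Propositional.Properties as Unique
open import Data.Nat using (ℕ; zero; suc; _+_; _*_; _∸_; _^_; _≤_; _<_; _/_; _%_; _<ᵇ_; _≡ᵇ_; z≤n; s≤s; _≟_)
open import Data.Nat.DivMod using (m≡m%n+[m/n]*n; m%n<n; m/n<m; m<n*o⇒m/o<n)
open import Data.Nat.ListAction using (sum)
open import Data.Nat.ListAction.Properties using (sum-++)
open import Data.Nat.Logarithm using (⌊log₂_⌋; ⌊log₂⌋-mono-≤; ⌊log₂[2^n]⌋≡n)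
open import Data.Nat.Properties
open import Data.Nat.Tactic.RingSolver using (solve-∀)
open import Data.Product using (Σ; _×_; _,_)
open import Data.Sum using (_⊎_; inj₁; inj₂)
open import Relation.Binary.Definitions using (DecidableEquality)
open import Relation.Binary.PropositionalEquality using (_≡_; refl; sym; trans; cong; cong₂; subst; module ≡-Reasoning)
open import Relation.Nullary using (¬_; yes; no; ¬?)

bitLength : ℕ → ℕ
bitLength n = length (bin n)

length-binF-suc : ∀ f m → length (binF (suc f) (suc m)) ≡ suc (length (binF f (suc m / 2)))
length-binF-suc f m = trans (length-++ (binF f (suc m / 2))) (+-comm _ 1)

length-binF-≤ : ∀ f n k → n < 2 ^ k → length (binF f n) ≤ k
length-binF-≤ zero    n       k       _  = z≤n
length-binF-≤ (suc f) zero    k       _  = z≤n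
length-binF-≤ (suc f) (suc m) zero    (s≤s ())
length-binF-≤ (suc f) (suc m) (suc k) n<2^1+k = begin
  length (binF (suc f) (suc m))        ≡⟨ length-binF-suc f m ⟩
  suc (length (binF f (suc m / 2)))    ≤⟨ s≤s (length-binF-≤ f (suc m / 2) k half<2^k) ⟩
  suc k                                ∎
  where
  open ≤-Reasoning
  half<2^k : suc m / 2 < 2 ^ k
  half<2^k = m<n*o⇒m/o<n (subst (suc m <_) (*-comm 2 (2 ^ k)) n<2^1+k)

<2^length-binF : ∀ f n → n ≤ f → n < 2 ^ length (binF f n)
<2^length-binF zero    zero    _         = s≤s z≤n
<2^length-binF (suc f) zero    _         = s≤s z≤n
<2^length-binF (suc f) n@(suc m) (s≤s m≤f) = begin-strict
  n                            ≡⟨ m≡m%n+[m/n]*n n 2 ⟩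
  n % 2 + n / 2 * 2            <⟨ +-monoˡ-< (n / 2 * 2) (m%n<n n 2) ⟩
  2 + n / 2 * 2                ≡⟨ *-comm (suc (n / 2)) 2 ⟩
  2 * suc (n / 2)              ≤⟨ *-monoʳ-≤ 2 (<2^length-binF f (n / 2) half≤f) ⟩
  2 * 2 ^ length (binF f (n / 2)) ≡⟨ cong (2 ^_) (length-binF-suc f m) ⟨
  2 ^ length (binF (suc f) n)  ∎
  where
  open ≤-Reasoning
  half≤f : n / 2 ≤ f
  half≤f = ≤-trans (≤-pred (m/n<m n 2 (s≤s (s≤s z≤n)))) m≤f

bitLength-≤ : ∀ {n k} → n < 2 ^ k → bitLength n ≤ k
bitLength-≤ {n} = length-binF-≤ n n _

<2^bitLength : ∀ n → n < 2 ^ bitLength n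
<2^bitLength n = <2^length-binF n n ≤-refl

binF<2 : ∀ f n → All (_< 2) (binF f n)
binF<2 zero    n       = []
binF<2 (suc f) zero    = []
binF<2 (suc f) (suc m) = ++⁺ (binF<2 f (suc m / 2)) (m%n<n (suc m) 2 ∷ [])

fold4 : ℕ → List ℕ → ℕ
fold4 = foldl (λ c d → 4 * c + d)

4^≡2^2* : ∀ n → 4 ^ n ≡ 2 ^ (2 * n)
4^≡2^2* = ^-*-assoc 2 2

fold4-+ : ∀ c d ds → fold4 (c + d) ds ≡ fold4 c ds + d * 4 ^ length ds
fold4-+ c d []       = cong (c +_) (sym (*-identityʳ d))
fold4-+ c d (e ∷ ds) = begin
  fold4 (4 * (c + d) + e) ds               ≡⟨ cong (λ z → fold4 z ds) (shift c d e) ⟩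
  fold4 ((4 * c + e) + 4 * d) ds           ≡⟨ fold4-+ (4 * c + e) (4 * d) ds ⟩
  fold4 (4 * c + e) ds + 4 * d * 4 ^ length ds ≡⟨ cong (fold4 (4 * c + e) ds +_) (regroup d (4 ^ length ds)) ⟩
  fold4 (4 * c + e) ds + d * (4 * 4 ^ length ds) ∎
  where
  open ≡-Reasoning
  shift : ∀ c d e → 4 * (c + d) + e ≡ (4 * c + e) + 4 * d
  shift = solve-∀
  regroup : ∀ d q → 4 * d * q ≡ d * (4 * q)
  regroup = solve-∀

fold4-lower : ∀ c ds → c * 4 ^ length ds ≤ fold4 c ds
fold4-lower c []       = ≤-reflexive (*-identityʳ c)
fold4-lower c (e ∷ ds) = begin
  c * (4 * 4 ^ length ds)    ≡⟨ *-assoc c 4 _ ⟨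
  c * 4 * 4 ^ length ds      ≤⟨ *-monoˡ-≤ (4 ^ length ds) (≤-trans (≤-reflexive (*-comm c 4)) (m≤m+n (4 * c) e)) ⟩
  (4 * c + e) * 4 ^ length ds ≤⟨ fold4-lower (4 * c + e) ds ⟩
  fold4 (4 * c + e) ds       ∎
  where open ≤-Reasoning

fold4-upper : ∀ c ds → All (_< 4) ds → fold4 c ds < suc c * 4 ^ length ds
fold4-upper c []       []           = ≤-reflexive (cong suc (sym (*-identityʳ c)))
fold4-upper c (e ∷ ds) (e<4 ∷ ds<4) = begin-strict
  fold4 (4 * c + e) ds              <⟨ fold4-upper (4 * c + e) ds ds<4 ⟩
  suc (4 * c + e) * 4 ^ length ds   ≤⟨ *-monoˡ-≤ (4 ^ length ds) next-digit ⟩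
  suc c * 4 * 4 ^ length ds         ≡⟨ *-assoc (suc c) 4 (4 ^ length ds) ⟩
  suc c * (4 * 4 ^ length ds)       ∎
  where
  open ≤-Reasoning
  next-digit : suc (4 * c + e) ≤ suc c * 4
  next-digit = begin
    suc (4 * c + e)  ≡⟨ cong suc (+-comm (4 * c) e) ⟩
    suc e + 4 * c    ≤⟨ +-monoˡ-≤ (4 * c) e<4 ⟩
    4 + 4 * c        ≡⟨ trans (*-comm (suc c) 4) (*-suc 4 c) ⟨
    suc c * 4        ∎

fold4-positive : ∀ ds → 0 < fold4 1 ds
fold4-positive ds = ≤-trans (m^n>0 4 (length ds)) (subst (_≤ fold4 1 ds) (*-identityˡ _) (fold4-lower 1 ds))

bitLength-fold4 : ∀ ds → All (_< 4) ds → bitLength (fold4 1 ds) ≡ suc (2 * length ds)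
bitLength-fold4 ds ds<4 = ≤-antisym (bitLength-≤ upper) (≰⇒> (λ ℓ≤2k → <⇒≱ (<2^bitLength x) (lower ℓ≤2k)))
  where
  x = fold4 1 ds
  k = length ds
  upper : x < 2 ^ suc (2 * k)
  upper = subst (x <_) (cong (2 *_) (4^≡2^2* k)) (fold4-upper 1 ds ds<4)
  lower : bitLength x ≤ 2 * k → 2 ^ bitLength x ≤ x
  lower ℓ≤2k = ≤-trans (^-monoʳ-≤ 2 ℓ≤2k)
    (subst (_≤ x) (trans (*-identityˡ (4 ^ k)) (4^≡2^2* k)) (fold4-lower 1 ds))

-- If c and x are the numerals of the digit strings cs and ds (with leading digit 1),
-- then appendCode c x is the numeral of cs ++ ds: the leading 1 of x has weight
-- 2 ^ (bitLength x ∸ 1) = 4 ^ length ds.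
appendCode : ℕ → ℕ → ℕ
appendCode c x = x + (c ∸ 1) * 2 ^ (bitLength x ∸ 1)

fold4-from : ∀ c ds → 0 < c → All (_< 4) ds → fold4 c ds ≡ appendCode c (fold4 1 ds)
fold4-from c ds 0<c ds<4 = begin
  fold4 c ds                           ≡⟨ cong (λ z → fold4 z ds) (m+[n∸m]≡n 0<c) ⟨
  fold4 (1 + (c ∸ 1)) ds               ≡⟨ fold4-+ 1 (c ∸ 1) ds ⟩
  fold4 1 ds + (c ∸ 1) * 4 ^ length ds ≡⟨ cong (λ e → fold4 1 ds + (c ∸ 1) * e) leading-weight ⟩
  appendCode c (fold4 1 ds)            ∎
  where
  open ≡-Reasoning
  leading-weight : 4 ^ length ds ≡ 2 ^ (bitLength (fold4 1 ds) ∸ 1)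
  leading-weight = trans (4^≡2^2* (length ds)) (cong (λ ℓ → 2 ^ (ℓ ∸ 1)) (sym (bitLength-fold4 ds ds<4)))

bitLength-appendCode : ∀ c x → bitLength (appendCode c x) ≤ bitLength c + bitLength x
bitLength-appendCode c x = bitLength-≤ (begin-strict
  x + (c ∸ 1) * 2 ^ (bitLength x ∸ 1) <⟨ +-mono-<-≤ (<2^bitLength x) (*-mono-≤ (m∸n≤m c 1) (^-monoʳ-≤ 2 (m∸n≤m (bitLength x) 1))) ⟩
  suc c * 2 ^ bitLength x              ≤⟨ *-monoˡ-≤ (2 ^ bitLength x) (<2^bitLength c) ⟩
  2 ^ bitLength c * 2 ^ bitLength x    ≡⟨ ^-distribˡ-+-* 2 (bitLength c) (bitLength x) ⟨
  2 ^ (bitLength c + bitLength x)      ∎)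
  where open ≤-Reasoning

blockLength : ℕ → ℕ
blockLength a = suc (bitLength a)

weight : List ℕ → ℕ
weight l = sum (map blockLength l)

digits<4 : ∀ l → All (_< 4) (digits l)
digits<4 []      = []
digits<4 (a ∷ l) = ++⁺ (++⁺ bits<4 (s≤s (s≤s (s≤s z≤n)) ∷ [])) (digits<4 l)
  where
  bits<4 : All (_< 4) (bin a)
  bits<4 = All.map (λ d<2 → <-trans d<2 (s≤s (s≤s (s≤s z≤n)))) (binF<2 a a)

digits-++ : ∀ xs ys → digits (xs ++ ys) ≡ digits xs ++ digits ys
digits-++ xs ys = trans (cong concat (map-++ _ xs ys)) (sym (concat-++ (map _ xs) (map _ ys)))

length-digits : ∀ l → length (digits l) ≡ weight l
length-digits []      = refl
length-digits (a ∷ l) = begin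
  length ((bin a ++ [ 2 ]) ++ digits l)            ≡⟨ length-++ (bin a ++ [ 2 ]) ⟩
  length (bin a ++ [ 2 ]) + length (digits l)      ≡⟨ cong₂ _+_ (trans (length-++ (bin a)) (+-comm (bitLength a) 1)) (length-digits l) ⟩
  blockLength a + weight l                         ∎
  where open ≡-Reasoning

bitLength-seqCode : ∀ l → bitLength (seqCode l) ≡ suc (2 * weight l)
bitLength-seqCode l = trans (bitLength-fold4 (digits l) (digits<4 l)) (cong (λ n → suc (2 * n)) (length-digits l))

seqCode-< : ∀ l → seqCode l < 2 ^ suc (2 * weight l)
seqCode-< l = subst (λ n → seqCode l < 2 ^ n) (bitLength-seqCode l) (<2^bitLength (seqCode l))

2*weight≤⌊log₂seqCode⌋ : ∀ l → 2 * weight l ≤ ⌊log₂ seqCode l ⌋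
2*weight≤⌊log₂seqCode⌋ l = begin
  2 * weight l                 ≡⟨ ⌊log₂[2^n]⌋≡n (2 * weight l) ⟨
  ⌊log₂ 2 ^ (2 * weight l) ⌋   ≤⟨ ⌊log₂⌋-mono-≤ 2^2w≤code ⟩
  ⌊log₂ seqCode l ⌋            ∎
  where
  open ≤-Reasoning
  2^2w≤code : 2 ^ (2 * weight l) ≤ seqCode l
  2^2w≤code = subst (_≤ seqCode l)
    (trans (*-identityˡ (4 ^ length (digits l))) (trans (4^≡2^2* (length (digits l))) (cong (λ n → 2 ^ (2 * n)) (length-digits l))))
    (fold4-lower 1 (digits l))

seqCode-++ : ∀ xs ys → seqCode (xs ++ ys) ≡ appendCode (seqCode xs) (seqCode ys)
seqCode-++ xs ys = begin
  fold4 1 (digits (xs ++ ys))             ≡⟨ cong (fold4 1) (digits-++ xs ys) ⟩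
  fold4 1 (digits xs ++ digits ys)        ≡⟨ foldl-++ _ 1 (digits xs) (digits ys) ⟩
  fold4 (seqCode xs) (digits ys)          ≡⟨ fold4-from (seqCode xs) (digits ys) (fold4-positive (digits xs)) (digits<4 ys) ⟩
  appendCode (seqCode xs) (seqCode ys)    ∎
  where open ≡-Reasoning

module _ {A B : Set} (f : B → ℕ) where

  sum-map-concatMap-≤ : ∀ (g : A → List B) (h : A → ℕ) → (∀ x → sum (map f (g x)) ≤ h x) →
                        ∀ xs → sum (map f (concatMap g xs)) ≤ sum (map h xs)
  sum-map-concatMap-≤ g h g≤h []       = z≤n
  sum-map-concatMap-≤ g h g≤h (x ∷ xs) = begin
    sum (map f (g x ++ concatMap g xs))                 ≡⟨ cong sum (map-++ f (g x) _) ⟩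
    sum (map f (g x) ++ map f (concatMap g xs))         ≡⟨ sum-++ (map f (g x)) _ ⟩
    sum (map f (g x)) + sum (map f (concatMap g xs))    ≤⟨ +-mono-≤ (g≤h x) (sum-map-concatMap-≤ g h g≤h xs) ⟩
    h x + sum (map h xs)                                ∎
    where open ≤-Reasoning

sum-map-*ˡ : ∀ {A : Set} (f : A → ℕ) k xs → sum (map (λ x → k * f x) xs) ≡ k * sum (map f xs)
sum-map-*ˡ f k []       = sym (*-zeroʳ k)
sum-map-*ˡ f k (x ∷ xs) = trans (cong (k * f x +_) (sum-map-*ˡ f k xs)) (sym (*-distribˡ-+ k (f x) _))

module _ {A : Set} (_≟ᴬ_ : DecidableEquality A) (f : A → ℕ) where

  without : A → List A → List A
  without y = filter (λ x → ¬? (x ≟ᴬ y))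

  sum-map-without : ∀ y {xs} → Unique xs → sum (map f xs) ≤ f y + sum (map f (without y xs))
  sum-map-without y {[]}     _                 = z≤n
  sum-map-without y {x ∷ xs} (x∉xs ∷ xs-unique) with x ≟ᴬ y
  ... | yes refl = ≤-reflexive (cong (λ l → f x + sum (map f l)) (sym (filter-all _ x∉rest)))
    where
    x∉rest : All (λ z → ¬ z ≡ x) xs
    x∉rest = All.map (λ x≢z z≡x → x≢z (sym z≡x)) x∉xs
  ... | no x≢y = begin
    f x + sum (map f xs)                       ≤⟨ +-monoʳ-≤ (f x) (sum-map-without y xs-unique) ⟩
    f x + (f y + sum (map f (without y xs)))   ≡⟨ +-assoc (f x) _ _ ⟨
    f x + f y + sum (map f (without y xs))     ≡⟨ cong (_+ sum (map f (without y xs))) (+-comm (f x) (f y)) ⟩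
    f y + f x + sum (map f (without y xs))     ≡⟨ +-assoc (f y) _ _ ⟩
    f y + sum (map f (x ∷ without y xs))       ∎
    where open ≤-Reasoning

  sum-map-⊆ : ∀ {xs} ys → Unique xs → xs ⊆ ys → sum (map f xs) ≤ sum (map f ys)
  sum-map-⊆ {[]}    []       _ _  = z≤n
  sum-map-⊆ {x ∷ _} []       _ xs⊆[] with xs⊆[] (here refl)
  ... | ()
  sum-map-⊆ {xs}    (y ∷ ys) xs-unique xs⊆y∷ys =
    ≤-trans (sum-map-without y xs-unique)
      (+-monoʳ-≤ (f y) (sum-map-⊆ ys (Unique.filter⁺ _ xs-unique) rest⊆ys))
    where
    rest⊆ys : without y xs ⊆ ys
    rest⊆ys z∈rest with ∈-filter⁻ _ z∈rest
    ... | z∈xs , z≢y with xs⊆y∷ys z∈xs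
    ...   | here z≡y   = ⊥-elim (z≢y z≡y)
    ...   | there z∈ys = z∈ys

∈-insertSet⁻ : ∀ {x} y ys → x ∈ insertSet y ys → x ≡ y ⊎ x ∈ ys
∈-insertSet⁻ y []       (here x≡y) = inj₁ x≡y
∈-insertSet⁻ y (z ∷ zs) x∈ with y <ᵇ z | y ≡ᵇ z
∈-insertSet⁻ y (z ∷ zs) (here x≡y)  | true  | _     = inj₁ x≡y
∈-insertSet⁻ y (z ∷ zs) (there x∈)  | true  | _     = inj₂ x∈
∈-insertSet⁻ y (z ∷ zs) x∈          | false | true  = inj₂ x∈
∈-insertSet⁻ y (z ∷ zs) (here x≡z)  | false | false = inj₂ (here x≡z)
∈-insertSet⁻ y (z ∷ zs) (there x∈)  | false | false with ∈-insertSet⁻ y zs x∈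
... | inj₁ x≡y  = inj₁ x≡y
... | inj₂ x∈zs = inj₂ (there x∈zs)

∈-insertSet⁺ˡ : ∀ y ys → y ∈ insertSet y ys
∈-insertSet⁺ˡ y []       = here refl
∈-insertSet⁺ˡ y (z ∷ zs) with y <ᵇ z | y ≡ᵇ z in y≡ᵇz
... | true  | _     = here refl
... | false | true  = here (≡ᵇ⇒≡ y z (subst T (sym y≡ᵇz) _))
... | false | false = there (∈-insertSet⁺ˡ y zs)

∈-insertSet⁺ʳ : ∀ {x} y ys → x ∈ ys → x ∈ insertSet y ys
∈-insertSet⁺ʳ y (z ∷ zs) x∈ with y <ᵇ z | y ≡ᵇ z
∈-insertSet⁺ʳ y (z ∷ zs) x∈          | true  | _     = there x∈
∈-insertSet⁺ʳ y (z ∷ zs) x∈          | false | true  = x∈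
∈-insertSet⁺ʳ y (z ∷ zs) (here x≡z)  | false | false = here x≡z
∈-insertSet⁺ʳ y (z ∷ zs) (there x∈)  | false | false = there (∈-insertSet⁺ʳ y zs x∈)

∈-toSortedSet⁻ : ∀ {x} l → x ∈ toSortedSet l → x ∈ l
∈-toSortedSet⁻ (y ∷ l) x∈ with ∈-insertSet⁻ y (toSortedSet l) x∈
... | inj₁ x≡y = here x≡y
... | inj₂ x∈  = there (∈-toSortedSet⁻ l x∈)

∈-toSortedSet⁺ : ∀ {x} l → x ∈ l → x ∈ toSortedSet l
∈-toSortedSet⁺ (y ∷ l) (here refl) = ∈-insertSet⁺ˡ y (toSortedSet l)
∈-toSortedSet⁺ (y ∷ l) (there x∈)  = ∈-insertSet⁺ʳ y (toSortedSet l) (∈-toSortedSet⁺ l x∈)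

insertSet-All : ∀ {P : ℕ → Set} y ys → P y → All P ys → All P (insertSet y ys)
insertSet-All y []       py []           = py ∷ []
insertSet-All y (z ∷ zs) py (pz ∷ pzs) with y <ᵇ z | y ≡ᵇ z
... | true  | _     = py ∷ pz ∷ pzs
... | false | true  = pz ∷ pzs
... | false | false = pz ∷ insertSet-All y zs py pzs

insertSet-sorted : ∀ y ys → AllPairs _<_ ys → AllPairs _<_ (insertSet y ys)
insertSet-sorted y []       []              = [] ∷ []
insertSet-sorted y (z ∷ zs) (z<zs ∷ sorted) with y <ᵇ z in y<ᵇz | y ≡ᵇ z in y≡ᵇz
... | true  | _     = (y<z ∷ All.map (<-trans y<z) z<zs) ∷ z<zs ∷ sorted
  where
  y<z : y < z
  y<z = <ᵇ⇒< y z (subst T (sym y<ᵇz) _)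
... | false | true  = z<zs ∷ sorted
... | false | false = insertSet-All y zs z<y z<zs ∷ insertSet-sorted y zs sorted
  where
  z<y : z < y
  z<y = ≤∧≢⇒< (≮⇒≥ (λ y<z → subst T y<ᵇz (<⇒<ᵇ y<z))) (λ z≡y → subst T y≡ᵇz (≡⇒≡ᵇ y z (sym z≡y)))

toSortedSet-unique : ∀ l → Unique (toSortedSet l)
toSortedSet-unique l = AllPairs.map <⇒≢ (sorted l)
  where
  sorted : ∀ l → AllPairs _<_ (toSortedSet l)
  sorted []      = []
  sorted (y ∷ l) = insertSet-sorted y (toSortedSet l) (sorted l)

relationSymbol : Bool → ℕ
relationSymbol true  = 4
relationSymbol false = 5

atomCodeOf : Bool → ℕ → ℕ → ℕ
atomCodeOf r c d = appendCode (seqCode [ relationSymbol r ]) (appendCode c d)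

atomCode-≐ : ∀ t s → atomCode (t ≐ s) ≡ atomCodeOf true (termCode t) (termCode s)
atomCode-≐ t s = trans (seqCode-++ [ 4 ] (polish t ++ polish s)) (cong (appendCode (seqCode [ 4 ])) (seqCode-++ (polish t) (polish s)))

atomCode-≼ : ∀ t s → atomCode (t ≼ s) ≡ atomCodeOf false (termCode t) (termCode s)
atomCode-≼ t s = trans (seqCode-++ [ 5 ] (polish t ++ polish s)) (cong (appendCode (seqCode [ 5 ])) (seqCode-++ (polish t) (polish s)))

bitLength-relationSymbol : ∀ r → bitLength (seqCode [ relationSymbol r ]) ≡ 9
bitLength-relationSymbol true  = refl
bitLength-relationSymbol false = refl

bitLength-atomCodeOf : ∀ r c d → bitLength (atomCodeOf r c d) ≤ 9 + (bitLength c + bitLength d)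
bitLength-atomCodeOf r c d = begin
  bitLength (atomCodeOf r c d)                                         ≤⟨ bitLength-appendCode (seqCode [ relationSymbol r ]) (appendCode c d) ⟩
  bitLength (seqCode [ relationSymbol r ]) + bitLength (appendCode c d) ≤⟨ +-mono-≤ (≤-reflexive (bitLength-relationSymbol r)) (bitLength-appendCode c d) ⟩
  9 + (bitLength c + bitLength d)                                      ∎
  where open ≤-Reasoning

entryCode : Bool → ℕ → ℕ → Bool → ℕ
entryCode r c d b = pairCode (atomCodeOf r c d) (bit b)

blockLength-entryCode : ∀ r c d b → blockLength (entryCode r c d b) ≤ 26 * blockLength c * blockLength d
blockLength-entryCode r c d b = begin
  blockLength (pairCode a (bit b))                        ≡⟨ cong suc (bitLength-seqCode (a ∷ bit b ∷ [])) ⟩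
  2 + 2 * (blockLength a + (blockLength (bit b) + 0))     ≤⟨ +-monoʳ-≤ 2 (*-monoʳ-≤ 2 (+-mono-≤ (s≤s (bitLength-atomCodeOf r c d)) (+-monoˡ-≤ 0 (bit-block b)))) ⟩
  2 + 2 * (10 + (bitLength c + bitLength d) + (2 + 0))    ≤⟨ quadratic (bitLength c) (bitLength d) ⟩
  26 * blockLength c * blockLength d                      ∎
  where
  open ≤-Reasoning
  a = atomCodeOf r c d
  bit-block : ∀ b → blockLength (bit b) ≤ 2
  bit-block true  = ≤-refl
  bit-block false = s≤s z≤n
  quadratic : ∀ x y → 2 + 2 * (10 + (x + y) + (2 + 0)) ≤ 26 * suc x * suc y
  quadratic x y = ≤-trans (m≤m+n _ (24 * x + 24 * y + 26 * (x * y))) (≤-reflexive (expand x y))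
    where
    expand : ∀ x y → 2 + 2 * (10 + (x + y) + (2 + 0)) + (24 * x + 24 * y + 26 * (x * y)) ≡ 26 * suc x * suc y
    expand = solve-∀

entriesAt : ℕ → ℕ → List ℕ
entriesAt c d = entryCode true c d true ∷ entryCode true c d false ∷ entryCode false c d true ∷ entryCode false c d false ∷ []

entriesOver : List ℕ → List ℕ
entriesOver S = concatMap (λ c → concatMap (entriesAt c) S) S

∈-entriesAt : ∀ r c d b → entryCode r c d b ∈ entriesAt c d
∈-entriesAt true  c d true  = here refl
∈-entriesAt true  c d false = there (here refl)
∈-entriesAt false c d true  = there (there (here refl))
∈-entriesAt false c d false = there (there (there (here refl)))

∈-entriesOver : ∀ {S c d} r b → c ∈ S → d ∈ S → entryCode r c d b ∈ entriesOver S
∈-entriesOver {c = c} {d} r b c∈S d∈S =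
  ∈-concatMap⁺ _ (lose c∈S (∈-concatMap⁺ (entriesAt c) (lose d∈S (∈-entriesAt r c d b))))

weight-entriesOver : ∀ S → weight (entriesOver S) ≤ weight S * (104 * weight S)
weight-entriesOver S = begin
  weight (entriesOver S)                        ≤⟨ sum-map-concatMap-≤ blockLength _ _ row S ⟩
  sum (map (λ c → L * (104 * blockLength c)) S) ≡⟨ sum-map-*ˡ (λ c → 104 * blockLength c) L S ⟩
  L * sum (map (λ c → 104 * blockLength c) S)   ≡⟨ cong (L *_) (sum-map-*ˡ blockLength 104 S) ⟩
  L * (104 * L)                                 ∎
  where
  open ≤-Reasoning
  L = weight S
  cell : ∀ c d → weight (entriesAt c d) ≤ 104 * blockLength c * blockLength d
  cell c d = ≤-trans
    (+-mono-≤ (blockLength-entryCode true c d true) (+-mono-≤ (blockLength-entryCode true c d false)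
      (+-mono-≤ (blockLength-entryCode false c d true) (+-monoˡ-≤ 0 (blockLength-entryCode false c d false)))))
    (≤-reflexive (four (blockLength c) (blockLength d)))
    where
    four : ∀ x y → 26 * x * y + (26 * x * y + (26 * x * y + (26 * x * y + 0))) ≡ 104 * x * y
    four = solve-∀
  row : ∀ c → weight (concatMap (entriesAt c) S) ≤ L * (104 * blockLength c)
  row c = begin
    weight (concatMap (entriesAt c) S)             ≤⟨ sum-map-concatMap-≤ blockLength _ _ (cell c) S ⟩
    sum (map (λ d → 104 * blockLength c * blockLength d) S) ≡⟨ sum-map-*ˡ blockLength (104 * blockLength c) S ⟩
    104 * blockLength c * L                        ≡⟨ *-comm _ L ⟩
    L * (104 * blockLength c)                      ∎

termCodes : List GroundTerm → List ℕ
termCodes Λ = toSortedSet (map termCode Λ)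

evalEntry : (Atom ⊥ → Bool) → Atom ⊥ → ℕ
evalEntry p φ = pairCode (atomCode φ) (bit (p φ))

∈-atomsOver⁻ : ∀ {Λ φ} → φ ∈ atomsOver Λ → AtomOver Λ φ
∈-atomsOver⁻ {Λ} φ∈ with find (∈-concatMap⁻ _ {xs = Λ} φ∈)
... | t , t∈Λ , φ∈row with find (∈-concatMap⁻ _ {xs = Λ} φ∈row)
...   | s , s∈Λ , here refl         = eqOver t∈Λ s∈Λ
...   | s , s∈Λ , there (here refl) = leOver t∈Λ s∈Λ

∈-termCodes : ∀ {Λ u} → u ∈ Λ → termCode u ∈ termCodes Λ
∈-termCodes {Λ} u∈Λ = ∈-toSortedSet⁺ (map termCode Λ) (∈-map⁺ termCode u∈Λ)

evalEntry-∈ : ∀ {Λ φ} p → AtomOver Λ φ → evalEntry p φ ∈ entriesOver (termCodes Λ)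
evalEntry-∈ {Λ} p (eqOver {t} {s} t∈Λ s∈Λ) =
  subst (_∈ entriesOver (termCodes Λ)) (cong (λ a → pairCode a (bit (p (t ≐ s)))) (sym (atomCode-≐ t s)))
    (∈-entriesOver true (p (t ≐ s)) (∈-termCodes t∈Λ) (∈-termCodes s∈Λ))
evalEntry-∈ {Λ} p (leOver {t} {s} t∈Λ s∈Λ) =
  subst (_∈ entriesOver (termCodes Λ)) (cong (λ a → pairCode a (bit (p (t ≼ s)))) (sym (atomCode-≼ t s)))
    (∈-entriesOver false (p (t ≼ s)) (∈-termCodes t∈Λ) (∈-termCodes s∈Λ))

evalEntries-⊆ : ∀ Λ p → toSortedSet (map (evalEntry p) (atomsOver Λ)) ⊆ entriesOver (termCodes Λ)
evalEntries-⊆ Λ p {a} a∈ = covered (∈-map⁻ (evalEntry p) (∈-toSortedSet⁻ (map (evalEntry p) (atomsOver Λ)) a∈))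
  where
  covered : Σ (Atom ⊥) (λ φ → φ ∈ atomsOver Λ × a ≡ evalEntry p φ) → a ∈ entriesOver (termCodes Λ)
  covered (φ , φ∈ , a≡) = subst (_∈ entriesOver (termCodes Λ)) (sym a≡) (evalEntry-∈ {Λ} p (∈-atomsOver⁻ {Λ} φ∈))

-- For L ≥ 1, 1 + 2 · 104 L² ≤ 53 (2 L)².
exponential-bound : ∀ {E} D L lg → D ≤ L * (104 * L) → 2 * L ≤ lg → E < 2 ^ suc (2 * D) →
                    E ≤ (2 ^ (lg ^ 2)) ^ 53 + 53
exponential-bound _ zero lg z≤n _ E<2 = ≤-trans (≤-pred E<2) (≤-trans (s≤s z≤n) (m≤n+m 53 ((2 ^ (lg ^ 2)) ^ 53)))
exponential-bound {E} D L@(suc L′) lg D≤ 2L≤lg E< = begin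
  E                        ≤⟨ <⇒≤ E< ⟩
  2 ^ suc (2 * D)          ≤⟨ ^-monoʳ-≤ 2 exponent ⟩
  2 ^ (lg ^ 2 * 53)        ≡⟨ ^-*-assoc 2 (lg ^ 2) 53 ⟨
  (2 ^ (lg ^ 2)) ^ 53      ≤⟨ m≤m+n ((2 ^ (lg ^ 2)) ^ 53) 53 ⟩
  (2 ^ (lg ^ 2)) ^ 53 + 53 ∎
  where
  open ≤-Reasoning
  expand : ∀ l → suc (2 * (suc l * (104 * suc l))) + (3 + 8 * l + 4 * (l * l)) ≡ 2 * suc l * (2 * suc l * 1) * 53
  expand = solve-∀
  exponent : suc (2 * D) ≤ lg ^ 2 * 53
  exponent = begin
    suc (2 * D)                           ≤⟨ s≤s (*-monoʳ-≤ 2 D≤) ⟩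
    suc (2 * (L * (104 * L)))             ≤⟨ m≤m+n (suc (2 * (L * (104 * L)))) (3 + 8 * L′ + 4 * (L′ * L′)) ⟩
    suc (2 * (L * (104 * L))) + (3 + 8 * L′ + 4 * (L′ * L′)) ≡⟨ expand L′ ⟩
    2 * L * (2 * L * 1) * 53              ≤⟨ *-monoˡ-≤ 53 (*-mono-≤ 2L≤lg (*-monoˡ-≤ 1 2L≤lg)) ⟩
    lg ^ 2 * 53                           ∎

evalCode-≤ : ∀ Λ p → evalCode Λ p ≤ ω₁ (setOfTermsCode Λ) ^ 53 + 53
evalCode-≤ Λ p =
  exponential-bound (weight entries) (weight S) ⌊log₂ setOfTermsCode Λ ⌋
    weight-bound (2*weight≤⌊log₂seqCode⌋ S) (seqCode-< entries)
  where
  S = termCodes Λ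
  entries = toSortedSet (map (evalEntry p) (atomsOver Λ))
  weight-bound : weight entries ≤ weight S * (104 * weight S)
  weight-bound = ≤-trans
    (sum-map-⊆ _≟_ blockLength (entriesOver S) (toSortedSet-unique (map (evalEntry p) (atomsOver Λ))) (evalEntries-⊆ Λ p))
    (weight-entriesOver S)

mainTheorem5 : Σ ℕ λ n → (Λ : List GroundTerm) → (p : Atom ⊥ → Bool) →
                 IsEvaluation Λ p → evalCode Λ p ≤ ω₁ (setOfTermsCode Λ) ^ n + n
mainTheorem5 = 53 , λ Λ p _ → evalCode-≤ Λ p
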